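{- Let $G$ be a median graph, let $E_i$ be a $\Theta$-class of $G$ with halfspaces $H_i'$ and $H_i''$, let $v\in V(H_i')$ be arbitrary, and let $v^*$ be its gate in $\partial H_i''$. Then $\mathrm{ecc}(v)=\max\{\mathrm{ecc}_{H_i'}(v),\ d(v,v^*)+\mathrm{ecc}_{H_i''}(v^*)\}$.
   Context: A finite connected simple graph $G$ is median if for every triple of distinct vertices $x,y,z$, $I(x,y)\cap I(y,z)\cap I(z,x)$ is a single vertex, where $I(a,b)=\{w: d(a,w)+d(w,b)=d(a,b)\}$. Two edges $uv,xy$ are in relation $\Theta_0$ if $u,v,y,x$ form a 4-cycle with $uv,xy$ opposite; $\Theta$ is the reflexive-transitive closure of $\Theta_0$, with classes called $\Theta$-classes. For a $\Theta$-class $E_i$, the graph $(V,E\setminus E_i)$ has exactly two connected components $H_i',H_i''$ (halfspaces), which are convex. $\partial H_i''$ is the set of vertices of $H_i''$ adjacent to a vertex of $H_i'$; it is gated. For a gated set $A$ and vertex $v$, the gate of $v$ in $A$ is the vertex $g\in A$ with $d(v,x)=d(v,g)+d(g,x)$ for all $x\in A$. $\mathrm{ecc}(v)=\max_w d(v,w)$ in $G$, and $\mathrm{ecc}_{H}(v)$ denotes the eccentricity of $v$ in the subgraph induced by $H$. -}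

module Defs where

open import Data.Nat using (ℕ; zero; suc; _+_; _≤_)
open import Data.Fin using (Fin)
open import Data.Product using (Σ; ∃; _×_; _,_)
open import Data.Sum using (_⊎_)
open import Relation.Nullary using (¬_; Dec)
open import Relation.Binary.PropositionalEquality using (_≡_; _≢_)
open import Relation.Binary.Construct.Closure.ReflexiveTransitive using (Star)

record Graph : Set₁ where
  field
    n     : ℕ
    Adj   : Fin n → Fin n → Set
    adj?  : ∀ u v → Dec (Adj u v)
    sym   : ∀ {u v} → Adj u v → Adj v u
    irr   : ∀ {u} → ¬ Adj u u

module _ {V : Set} where

  data WalkR (R : V → V → Set) : V → V → ℕ → Set where
    [] : ∀ {u} → WalkR R u u zero
    _∷_ : ∀ {u w v k} → R u w → WalkR R w v k → WalkR R u v (suc k)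

  DistR : (R : V → V → Set) → V → V → ℕ → Set
  DistR R u v k = WalkR R u v k × (∀ m → WalkR R u v m → k ≤ m)

  Reach : (R : V → V → Set) → V → V → Set
  Reach R u v = ∃ λ k → WalkR R u v k

  Induced : (R : V → V → Set) → (V → Set) → V → V → Set
  Induced R H u w = R u w × H u × H w

module _ (G : Graph) where
  open Graph G

  V : Set
  V = Fin n

  Dist : V → V → ℕ → Set
  Dist = DistR Adj

  Connected : Set
  Connected = ∀ u v → Reach Adj u v

  InInterval : V → V → V → Set
  InInterval a b w = ∃ λ p → ∃ λ q → ∃ λ r →
    Dist a w p × Dist w b q × Dist a b r × (p + q ≡ r)

  InMedianSet : V → V → V → V → Set
  InMedianSet x y z m = InInterval x y m × InInterval y z m × InInterval z x m

  IsMedian : Set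
  IsMedian = Connected ×
    (∀ x y z → x ≢ y → y ≢ z → x ≢ z →
      ∃ λ m → InMedianSet x y z m × (∀ m' → InMedianSet x y z m' → m' ≡ m))

  -- Edges are represented by ordered pairs of adjacent vertices.
  -- Θ₀ (u,v) (x,y): u,v,y,x form a 4-cycle with uv and xy opposite edges.
  Θ₀ : V × V → V × V → Set
  Θ₀ (u , v) (x , y) =
    Adj u v × Adj v y × Adj y x × Adj x u ×
    u ≢ v × u ≢ y × u ≢ x × v ≢ y × v ≢ x × y ≢ x

  Rev : V × V → V × V → Set
  Rev (u , v) (x , y) = (x ≡ v) × (y ≡ u)

  -- Θ: reflexive-transitive closure of Θ₀ on undirected edges.
  Θ : V × V → V × V → Set
  Θ = Star (λ e f → Θ₀ e f ⊎ Rev e f)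

  -- The Θ-class E of the edge ab: edges uw with Θ (u,w) (a,b).
  -- Adjacency of the graph (V, E ∖ E).
  AdjMinus : V → V → V → V → Set
  AdjMinus a b u w = Adj u w × ¬ Θ (u , w) (a , b)

  H′ : V → V → V → Set
  H′ a b = Reach (AdjMinus a b) a

  H″ : V → V → V → Set
  H″ a b = Reach (AdjMinus a b) b

  ∂H″ : V → V → V → Set
  ∂H″ a b x = H″ a b x × ∃ λ y → H′ a b y × Adj x y

  IsGate : (V → Set) → V → V → Set
  IsGate A v g = A g ×
    (∀ x → A x → ∀ p q r → Dist v x p → Dist v g q → Dist g x r → p ≡ q + r)

  Ecc : V → ℕ → Set
  Ecc v e = (∀ w k → Dist v w k → k ≤ e) × ∃ λ w → Dist v w e

  EccIn : (V → Set) → V → ℕ → Set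
  EccIn H v e =
    (∀ w → H w → ∀ k → DistR (Induced Adj H) v w k → k ≤ e) ×
    ∃ λ w → H w × DistR (Induced Adj H) v w e

-- In a median graph the distances from any vertex c to the two ends of an edge differ by
-- exactly one, and the median of two opposite corners of a 4-cycle and c is the unique
-- corner nearest to c.  Hence opposite edges of a square point the same way as seen from
-- every vertex of W(a,b) = {c | d(c,a) < d(c,b)}, while descending towards ab along squares
-- shows that every edge from W(a,b) to W(b,a) is Θ-related to ab.  So the halfspaces of ab
-- are exactly W(a,b) and W(b,a); both are convex, so their induced metrics are restrictions
-- of d.  For w in H″ a geodesic from v to w leaves H′ along an edge st with t in ∂H″, and the
-- gate property at t gives d(v,w) = d(v,v*) + d(v*,w).  Sorting the vertices of G by
-- halfspace then bounds ecc(v) by the maximum, and both terms are attained.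
module Submission where

open import Defs
open import Data.Nat using (ℕ; zero; suc; _+_; _⊔_; _≤_; _<_; s≤s)
open import Data.Nat.Properties
open import Data.Nat.Induction using (<-rec)
open import Data.Fin using () renaming (_≟_ to _≟ᶠ_)
open import Data.Fin.Properties using (any?)
open import Data.Product using (_×_; _,_; proj₁; proj₂; ∃; ∃₂)
open import Data.Sum using (_⊎_; inj₁; inj₂; swap)
open import Data.Empty using (⊥; ⊥-elim)
open import Function using (_∘_)
open import Relation.Nullary using (¬_; Dec; yes; no; _×-dec_)
open import Relation.Binary.PropositionalEquality
open import Relation.Binary.Construct.Closure.ReflexiveTransitive using (ε; _◅_; _◅◅_)

module _ {P : ℕ → Set} (P? : ∀ k → Dec (P k)) where

  least-witness : ∀ {m} → P m → ∃ λ k → P k × (∀ j → P j → k ≤ j)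
  least-witness {m} = <-rec (λ m → P m → ∃ λ k → P k × (∀ j → P j → k ≤ j)) search m
    where
    search : ∀ m → (∀ {j} → j < m → P j → ∃ λ k → P k × (∀ j → P j → k ≤ j)) →
             P m → ∃ λ k → P k × (∀ j → P j → k ≤ j)
    search m below pm with anyUpTo? P? m
    ... | yes (j , j<m , pj) = below j<m pj
    ... | no none = m , pm , λ j pj → ≮⇒≥ λ j<m → none (j , j<m , pj)

module _ {V : Set} where

  _++ʷ_ : ∀ {R : V → V → Set} {u x w k l} → WalkR R u x k → WalkR R x w l → WalkR R u w (k + l)
  [] ++ʷ q = q
  (e ∷ p) ++ʷ q = e ∷ (p ++ʷ q)

  _∷ʳ_ : ∀ {R : V → V → Set} {u x w k} → WalkR R u x k → R x w → WalkR R u w (suc k)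
  [] ∷ʳ e = e ∷ []
  (e ∷ p) ∷ʳ e′ = e ∷ (p ∷ʳ e′)

  reverseʷ : ∀ {R : V → V → Set} → (∀ {u w} → R u w → R w u) →
             ∀ {u w k} → WalkR R u w k → WalkR R w u k
  reverseʷ R-sym [] = []
  reverseʷ R-sym (e ∷ p) = reverseʷ R-sym p ∷ʳ R-sym e

  empty-walk⇒≡ : ∀ {R : V → V → Set} {u w} → WalkR R u w 0 → u ≡ w
  empty-walk⇒≡ [] = refl

  uncons : ∀ {R : V → V → Set} {u w k} → WalkR R u w (suc k) → ∃ λ x → R u x × WalkR R x w k
  uncons (e ∷ p) = _ , e , p

  mapʷ : ∀ {R S : V → V → Set} → (∀ {u w} → R u w → S u w) →
         ∀ {u w k} → WalkR R u w k → WalkR S u w k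
  mapʷ f [] = []
  mapʷ f (e ∷ p) = f e ∷ mapʷ f p

  DistR-unique : ∀ {R : V → V → Set} {u w k l} → DistR R u w k → DistR R u w l → k ≡ l
  DistR-unique (p , p-min) (q , q-min) = ≤-antisym (p-min _ q) (q-min _ p)

module _ (G : Graph) where
  open Graph G

  Θ-reverse : ∀ {e x y} → Θ G e (x , y) → Θ G e (y , x)
  Θ-reverse θ = θ ◅◅ (inj₂ (refl , refl) ◅ ε)

  H″⇒H′-swap : ∀ {a b w} → H″ G a b w → H′ G b a w
  H″⇒H′-swap (k , p) = k , mapʷ (λ (e , ¬θ) → e , ¬θ ∘ Θ-reverse) p

  H′-swap⇒H″ : ∀ {a b w} → H′ G b a w → H″ G a b w
  H′-swap⇒H″ (k , p) = k , mapʷ (λ (e , ¬θ) → e , ¬θ ∘ Θ-reverse) p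

module Metric (G : Graph) (connected : Connected G) where
  open Graph G renaming (sym to Adj-sym)

  Walk : V G → V G → ℕ → Set
  Walk = WalkR Adj

  walk? : ∀ k u w → Dec (Walk u w k)
  walk? zero u w with u ≟ᶠ w
  ... | yes refl = yes []
  ... | no u≢w = no λ { [] → u≢w refl }
  walk? (suc k) u w with any? (λ x → adj? u x ×-dec walk? k x w)
  ... | yes (x , e , p) = yes (e ∷ p)
  ... | no none = no λ { (e ∷ p) → none (_ , e , p) }

  shortest : ∀ u w → ∃ (Dist G u w)
  shortest u w = least-witness (λ k → walk? k u w) (proj₂ (connected u w))

  -- Opaque so that conversion checking never unfolds the minimisation behind d.
  opaque
    d : V G → V G → ℕ
    d u w = proj₁ (shortest u w)

    d-dist : ∀ u w → Dist G u w (d u w)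
    d-dist u w = proj₂ (shortest u w)

  geodesic : ∀ u w → Walk u w (d u w)
  geodesic u w = proj₁ (d-dist u w)

  d-minimal : ∀ {u w k} → Walk u w k → d u w ≤ k
  d-minimal {u} {w} p = proj₂ (d-dist u w) _ p

  Dist⇒≡d : ∀ {u w k} → Dist G u w k → k ≡ d u w
  Dist⇒≡d {u} {w} δ = DistR-unique δ (d-dist u w)

  d-sym : ∀ u w → d u w ≡ d w u
  d-sym u w = ≤-antisym (d-minimal (reverseʷ Adj-sym (geodesic w u)))
                        (d-minimal (reverseʷ Adj-sym (geodesic u w)))

  d-triangle : ∀ u x w → d u w ≤ d u x + d x w
  d-triangle u x w = d-minimal (geodesic u x ++ʷ geodesic x w)

  d-refl : ∀ u → d u u ≡ 0
  d-refl u = n≤0⇒n≡0 (d-minimal [])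

  d≡0⇒≡ : ∀ {u w} → d u w ≡ 0 → u ≡ w
  d≡0⇒≡ {u} {w} eq = empty-walk⇒≡ (subst (Walk u w) eq (geodesic u w))

  d≡suc⇒≢ : ∀ {u w k} → d u w ≡ suc k → u ≢ w
  d≡suc⇒≢ {u} eq refl = 0≢1+n (trans (sym (d-refl u)) eq)

  adj⇒≢ : ∀ {u w} → Adj u w → u ≢ w
  adj⇒≢ e refl = irr e

  levels-apart⇒≢ : ∀ {x y c k} → d x c ≡ k → d y c ≡ suc (suc k) → x ≢ y
  levels-apart⇒≢ {k = k} xc yc refl = m≢1+n+m k (trans (sym xc) yc)

  adj⇒d≡1 : ∀ {u w} → Adj u w → d u w ≡ 1
  adj⇒d≡1 e = ≤-antisym (d-minimal (e ∷ [])) (n≢0⇒n>0 (λ eq → irr (subst (Adj _) (sym (d≡0⇒≡ eq)) e)))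

  d-adjˡ-≤ : ∀ {u x} w → Adj u x → d u w ≤ suc (d x w)
  d-adjˡ-≤ {x = x} w e = d-minimal (e ∷ geodesic x w)

  d-adjʳ-≤ : ∀ {x y} c → Adj x y → d c y ≤ suc (d c x)
  d-adjʳ-≤ {x} c e = d-minimal (geodesic c x ∷ʳ e)

  geodesic-tail : ∀ {u x w k} → Adj u x → Walk x w k → suc k ≡ d u w → d x w ≡ k
  geodesic-tail {w = w} e p h = ≤-antisym (d-minimal p) (≤-pred (subst (_≤ _) (sym h) (d-adjˡ-≤ w e)))

  geodesic-step : ∀ {u w k} → d u w ≡ suc k → ∃ λ x → Adj u x × d x w ≡ k
  geodesic-step {u} {w} eq =
    let x , e , p = uncons (subst (Walk u w) eq (geodesic u w)) in x , e , geodesic-tail e p (sym eq)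

  d≡1⇒adj : ∀ {u w} → d u w ≡ 1 → Adj u w
  d≡1⇒adj {u} eq = let x , e , xw = geodesic-step eq in subst (Adj u) (d≡0⇒≡ xw) e

  interval⇒d : ∀ {x y w} → InInterval G x y w → d x w + d w y ≡ d x y
  interval⇒d (_ , _ , _ , xw , wy , xy , eq) =
    subst₂ (λ p q → p + q ≡ _) (Dist⇒≡d xw) (Dist⇒≡d wy) (trans eq (Dist⇒≡d xy))

  d⇒interval : ∀ {x y w} → d x w + d w y ≡ d x y → InInterval G x y w
  d⇒interval {x} {y} {w} eq = _ , _ , _ , d-dist x w , d-dist w y , d-dist x y , eq

  Convex : (V G → Set) → Set
  Convex S = ∀ {x t y} → S x → S y → Adj x t → suc (d t y) ≡ d x y → S t

  geodesic-inside : ∀ {S} → Convex S → ∀ {x y k} → Walk x y k → k ≡ d x y → S x → S y →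
                    WalkR (Induced Adj S) x y k
  geodesic-inside conv [] _ Sx Sy = []
  geodesic-inside {S} conv {y = y} (_∷_ {w = t} {k = k} e p) h Sx Sy =
    (e , Sx , St) ∷ geodesic-inside conv p (sym tail) St Sy
    where
    tail : d t y ≡ k
    tail = geodesic-tail e p h
    St : S t
    St = conv Sx Sy e (trans (cong suc tail) h)

  convex⇒induced-dist : ∀ {S T} → Convex S → (∀ {x} → S x → T x) →
                        ∀ {x y} → S x → S y → DistR (Induced Adj T) x y (d x y)
  convex⇒induced-dist conv S⊆T {x} {y} Sx Sy =
    mapʷ (λ (e , Su , Sw) → e , S⊆T Su , S⊆T Sw) (geodesic-inside conv (geodesic x y) refl Sx Sy) ,
    λ _ p → d-minimal (mapʷ proj₁ p)

two-halves : ∀ x → x + x ≡ 2 → x ≡ 1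
two-halves 1 _ = refl
two-halves (suc (suc x)) eq = ⊥-elim (0≢1+n (sym (m+n≡0⇒n≡0 x (suc-injective (suc-injective eq)))))

two-halves-of-triangle : ∀ {x y z K} → x + y ≡ 2 → y + z ≡ K → z + x ≡ K → x ≡ 1 × y ≡ 1
two-halves-of-triangle {x} {y} {z} x+y yz zx
  with refl ← +-cancelʳ-≡ z y x (trans yz (sym (trans (+-comm x z) zx))) =
  two-halves x x+y , two-halves x x+y

module Median (G : Graph) (isMedian : IsMedian G) where
  open Graph G renaming (sym to Adj-sym)
  open Metric G (proj₁ isMedian)

  Away : V G → V G → V G → Set
  Away c s t = d c t ≡ suc (d c s)

  W : V G → V G → V G → Set
  W a b c = Away c a b

  away-from-self : ∀ {c t} → Adj c t → Away c c t
  away-from-self {c} e = trans (adj⇒d≡1 e) (cong suc (sym (d-refl c)))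

  interval-of-edge : ∀ {s t m} → Adj s t → InInterval G s t m → m ≡ s ⊎ m ≡ t
  interval-of-edge {s} {t} {m} e I with d s m in eq
  ... | zero = inj₁ (sym (d≡0⇒≡ eq))
  ... | suc j = inj₂ (d≡0⇒≡ (m+n≡0⇒n≡0 j (suc-injective (trans (cong (_+ d m t) (sym eq))
                                                              (trans (interval⇒d I) (adj⇒d≡1 e))))))

  away-or-back : ∀ c {s t} → Adj s t → Away c s t ⊎ Away c t s
  away-or-back c {s} {t} e with c ≟ᶠ s | c ≟ᶠ t
  ... | yes refl | _ = inj₁ (away-from-self e)
  ... | no _ | yes refl = inj₂ (away-from-self (Adj-sym e))
  ... | no c≢s | no c≢t with proj₂ isMedian c s t c≢s (adj⇒≢ e) c≢t
  ...   | m , (Ics , Ist , Itc) , _ with interval-of-edge e Ist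
  ...     | inj₁ refl = inj₁ (begin
              d c t         ≡⟨ d-sym c t ⟩
              d t c         ≡⟨ sym (interval⇒d Itc) ⟩
              d t m + d m c ≡⟨ cong₂ _+_ (adj⇒d≡1 (Adj-sym e)) (d-sym m c) ⟩
              suc (d c m)   ∎)
    where open ≡-Reasoning
  ...     | inj₂ refl = inj₂ (begin
              d c s         ≡⟨ sym (interval⇒d Ics) ⟩
              d c m + d m s ≡⟨ cong (d c m +_) (adj⇒d≡1 (Adj-sym e)) ⟩
              d c m + 1     ≡⟨ +-comm (d c m) 1 ⟩
              suc (d c m)   ∎)
    where open ≡-Reasoning

  triangle-free : ∀ {α β γ} → Adj α β → Adj β γ → ¬ Adj α γ
  triangle-free {α} {β} {γ} αβ βγ αγ with away-or-back β αγ
  ... | inj₁ away = <⇒≢ (n<1+n 1) (trans (sym (adj⇒d≡1 βγ)) (trans away (cong suc (adj⇒d≡1 (Adj-sym αβ)))))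
  ... | inj₂ back = <⇒≢ (n<1+n 1) (trans (sym (adj⇒d≡1 (Adj-sym αβ))) (trans back (cong suc (adj⇒d≡1 βγ))))

  d≡2 : ∀ {α β γ} → Adj α β → Adj β γ → α ≢ γ → d α γ ≡ 2
  d≡2 {α} {β} {γ} αβ βγ α≢γ with d α γ in eq | d-minimal (αβ ∷ (βγ ∷ []))
  ... | 0 | _ = ⊥-elim (α≢γ (d≡0⇒≡ eq))
  ... | 1 | _ = ⊥-elim (triangle-free αβ βγ (d≡1⇒adj eq))
  ... | 2 | _ = refl
  ... | suc (suc (suc _)) | s≤s (s≤s ())

  lower-common-neighbour-unique :
    ∀ {c α β γ δ k} → Adj α β → Adj β γ → Adj α δ → Adj δ γ → α ≢ γ →
    d c β ≡ k → d c δ ≡ k → d c α ≡ suc k → d c γ ≡ suc k → β ≡ δ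
  lower-common-neighbour-unique {c} {α} {β} {γ} {δ} {k} αβ βγ αδ δγ α≢γ cβ cδ cα cγ
    with proj₂ isMedian α γ c α≢γ (≢-sym (d≡suc⇒≢ cγ)) (≢-sym (d≡suc⇒≢ cα))
  ... | _ , _ , unique = trans (unique β (in-median αβ βγ cβ)) (sym (unique δ (in-median αδ δγ cδ)))
    where
    in-median : ∀ {x} → Adj α x → Adj x γ → d c x ≡ k → InMedianSet G α γ c x
    in-median {x} αx xγ cx =
      d⇒interval (trans (cong₂ _+_ (adj⇒d≡1 αx) (adj⇒d≡1 xγ)) (sym (d≡2 αx xγ α≢γ))) ,
      d⇒interval (trans (cong₂ _+_ (adj⇒d≡1 (Adj-sym xγ)) (trans (d-sym x c) cx))
                        (sym (trans (d-sym γ c) cγ))) ,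
      d⇒interval (trans (cong₂ _+_ cx (adj⇒d≡1 (Adj-sym αx))) (trans (+-comm k 1) (sym cα)))

  Θ₀-flip : ∀ {u v x y} → Θ₀ G (u , v) (x , y) → Θ₀ G (v , u) (y , x)
  Θ₀-flip (uv , vy , yx , xu , u≢v , u≢y , u≢x , v≢y , v≢x , y≢x) =
    Adj-sym uv , Adj-sym xu , Adj-sym yx , Adj-sym vy ,
    ≢-sym u≢v , v≢x , v≢y , u≢x , u≢y , ≢-sym y≢x

  -- The two other orientations would give the square two lower common neighbours of
  -- opposite corners, or an edge across which the distance to c jumps by three.
  Θ₀-preserves-Away : ∀ c {u v x y} → Θ₀ G (u , v) (x , y) → Away c x y → Away c u v
  Θ₀-preserves-Away c {u} {v} {x} {y} (uv , vy , yx , xu , _ , u≢y , _ , _ , v≢x , _) cxy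
    with away-or-back c uv
  ... | inj₁ cuv = cuv
  ... | inj₂ cvu with away-or-back c xu
  ...   | inj₁ cxu = ⊥-elim (v≢x (lower-common-neighbour-unique uv vy (Adj-sym xu) (Adj-sym yx) u≢y
                         (suc-injective (trans (sym cvu) cxu)) refl cxu cxy))
  ...   | inj₂ cux = ⊥-elim (1+n≰n (≤-trans (n≤1+n _)
                         (subst (_≤ suc (d c v)) (trans cxy (cong suc (trans cux (cong suc cvu)))) (d-adjʳ-≤ c vy))))

  quadrangle : ∀ {s t b k} → d s t ≡ 2 → d s b ≡ suc k → d t b ≡ suc k →
               ∃ λ m → Adj s m × Adj m t × d m b ≡ k
  quadrangle {s} {t} {b} {k} st sb tb
    with proj₂ isMedian s t b (d≡suc⇒≢ st) (d≡suc⇒≢ tb) (d≡suc⇒≢ sb)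
  ... | m , (Ist , Itb , Ibs) , _ = m , d≡1⇒adj sm , d≡1⇒adj mt , mb
    where
    sides : d s m ≡ 1 × d m t ≡ 1
    sides = two-halves-of-triangle {d s m} {d m t} {d m b}
              (trans (interval⇒d Ist) st)
              (trans (cong (_+ d m b) (d-sym m t)) (trans (interval⇒d Itb) tb))
              (trans (cong₂ _+_ (d-sym m b) (d-sym s m)) (trans (interval⇒d Ibs) (trans (d-sym b s) sb)))
    sm : d s m ≡ 1
    sm = proj₁ sides
    mt : d m t ≡ 1
    mt = proj₂ sides
    mb : d m b ≡ k
    mb = suc-injective (trans (cong (_+ d m b) (sym (trans (d-sym t m) mt))) (trans (interval⇒d Itb) tb))

module ThetaClass (G : Graph) (isMedian : IsMedian G) (a b : V G) (ab : Graph.Adj G a b) where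
  open Graph G renaming (sym to Adj-sym)
  open Metric G (proj₁ isMedian)
  open Median G isMedian

  side : ∀ c → W a b c ⊎ W b a c
  side c = away-or-back c ab

  W-disjoint : ∀ {c} → W a b c → W b a c → ⊥
  W-disjoint Wc W′c = m≢1+n+m _ (trans Wc (cong suc W′c))

  Crossing : V G → V G → Set
  Crossing s t = Adj s t × W a b s × W b a t

  crossing-level : ∀ {s t} → Crossing s t → d s a ≡ d t b
  crossing-level {s} {t} (st , Ws , W′t) = suc-injective (≤-antisym
    (subst (_≤ suc (d t b)) Ws (d-adjˡ-≤ b st))
    (subst (_≤ suc (d s a)) W′t (d-adjˡ-≤ a (Adj-sym st))))

  crossing-square : ∀ {s t s′ k} → Crossing s t → d s a ≡ suc k → Adj s s′ → d s′ a ≡ k →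
                    ∃ λ t′ → Crossing s′ t′ × Θ₀ G (s , t) (s′ , t′)
  crossing-square {s} {t} {s′} {k} cr@(st , Ws , W′t) sa ss′ s′a = complete (quadrangle s′t s′b tb)
    where
    tb : d t b ≡ suc k
    tb = trans (sym (crossing-level cr)) sa
    ta : d t a ≡ suc (suc k)
    ta = trans W′t (cong suc tb)
    sb : d s b ≡ suc (suc k)
    sb = trans Ws (cong suc sa)
    s′≢t : s′ ≢ t
    s′≢t = levels-apart⇒≢ s′a ta
    s′t : d s′ t ≡ 2
    s′t = d≡2 (Adj-sym ss′) st s′≢t
    s′b : d s′ b ≡ suc k
    s′b = ≤-antisym (subst (d s′ b ≤_) (trans (cong₂ _+_ s′a (adj⇒d≡1 ab)) (+-comm k 1)) (d-triangle s′ a b))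
                    (≤-pred (subst (_≤ suc (d s′ b)) sb (d-adjˡ-≤ b ss′)))
    complete : (∃ λ t′ → Adj s′ t′ × Adj t′ t × d t′ b ≡ k) →
               ∃ λ t′ → Crossing s′ t′ × Θ₀ G (s , t) (s′ , t′)
    complete (t′ , s′t′ , t′t , t′b) = t′ , (s′t′ , Ws′ , W′t′) , square
      where
      Ws′ : W a b s′
      Ws′ = trans s′b (cong suc (sym s′a))
      t′a : d t′ a ≡ suc k
      t′a = ≤-antisym (subst (d t′ a ≤_) (cong suc s′a) (d-adjˡ-≤ a (Adj-sym s′t′)))
                      (≤-pred (subst (_≤ suc (d t′ a)) ta (d-adjˡ-≤ a (Adj-sym t′t))))
      W′t′ : W b a t′
      W′t′ = trans t′a (cong suc (sym t′b))
      square : Θ₀ G (s , t) (s′ , t′)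
      square = st , Adj-sym t′t , Adj-sym s′t′ , Adj-sym ss′ ,
               adj⇒≢ st , ≢-sym (levels-apart⇒≢ t′b sb) , adj⇒≢ ss′ ,
               ≢-sym (adj⇒≢ t′t) , ≢-sym s′≢t , ≢-sym (adj⇒≢ s′t′)

  crossing-Θ : ∀ {s t} → Crossing s t → Θ G (s , t) (a , b)
  crossing-Θ cr = descend _ cr refl
    where
    descend : ∀ k {s t} → Crossing s t → d s a ≡ k → Θ G (s , t) (a , b)
    descend zero cr sa = subst₂ (λ s t → Θ G (s , t) (a , b))
      (sym (d≡0⇒≡ sa)) (sym (d≡0⇒≡ (trans (sym (crossing-level cr)) sa))) ε
    descend (suc k) cr sa =
      let s′ , ss′ , s′a = geodesic-step sa
          t′ , cr′ , square = crossing-square cr sa ss′ s′a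
      in inj₁ square ◅ descend k cr′ s′a

  Oriented : V G × V G → Set
  Oriented (s , t) = ∀ c → W a b c → Away c s t

  Oriented± : V G × V G → Set
  Oriented± (s , t) = Oriented (s , t) ⊎ Oriented (t , s)

  Θ-preserves-Oriented± : ∀ {e f} → Θ G e f → Oriented± f → Oriented± e
  Θ-preserves-Oriented± ε o = o
  Θ-preserves-Oriented± (inj₁ square ◅ θ) o with Θ-preserves-Oriented± θ o
  ... | inj₁ o′ = inj₁ λ c Wc → Θ₀-preserves-Away c square (o′ c Wc)
  ... | inj₂ o′ = inj₂ λ c Wc → Θ₀-preserves-Away c (Θ₀-flip square) (o′ c Wc)
  Θ-preserves-Oriented± (inj₂ (refl , refl) ◅ θ) o = swap (Θ-preserves-Oriented± θ o)

  Θ-class-Oriented± : ∀ {e} → Θ G e (a , b) → Oriented± e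
  Θ-class-Oriented± θ = Θ-preserves-Oriented± θ (inj₁ λ _ Wc → Wc)

  oriented⇒head∉W : ∀ {s t} → Oriented (s , t) → ¬ W a b t
  oriented⇒head∉W {t = t} o Wt = 0≢1+n (trans (sym (d-refl t)) (o t Wt))

  crossing-Oriented : ∀ {s t} → Crossing s t → Oriented (s , t)
  crossing-Oriented cr@(_ , Ws , _) with Θ-class-Oriented± (crossing-Θ cr)
  ... | inj₁ o = o
  ... | inj₂ o = ⊥-elim (oriented⇒head∉W o Ws)

  W-edge-∉Θ : ∀ {x t} → W a b x → W a b t → ¬ Θ G (x , t) (a , b)
  W-edge-∉Θ Wx Wt θ with Θ-class-Oriented± θ
  ... | inj₁ o = oriented⇒head∉W o Wt
  ... | inj₂ o = oriented⇒head∉W o Wx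

  W-convex : Convex (W a b)
  W-convex {x} {t} {y} Wx Wy xt xty with side t
  ... | inj₁ Wt = Wt
  ... | inj₂ W′t = ⊥-elim (m≢1+n+m (d t y) (begin
    d t y       ≡⟨ d-sym t y ⟩
    d y t       ≡⟨ crossing-Oriented (xt , Wx , W′t) y Wy ⟩
    suc (d y x) ≡⟨ cong suc (trans (d-sym y x) (sym xty)) ⟩
    suc (suc (d t y)) ∎))
    where open ≡-Reasoning

  H′⇒W : ∀ {w} → H′ G a b w → W a b w
  H′⇒W (_ , p) = stays p (away-from-self ab)
    where
    stays : ∀ {x w k} → WalkR (AdjMinus G a b) x w k → W a b x → W a b w
    stays [] Wx = Wx
    stays (_∷_ {w = t} (xt , ∉Θ) p) Wx with side t
    ... | inj₁ Wt = stays p Wt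
    ... | inj₂ W′t = ⊥-elim (∉Θ (crossing-Θ (xt , Wx , W′t)))

  W⇒H′ : ∀ {w} → W a b w → H′ G a b w
  W⇒H′ {w} Ww = _ , mapʷ (λ (e , Wx , Wt) → e , W-edge-∉Θ Wx Wt)
                         (geodesic-inside W-convex (geodesic a w) refl (away-from-self ab) Ww)

  walk-crosses : ∀ {x y k} → Walk x y k → W a b x → W b a y →
                 ∃₂ λ s t → Crossing s t × d x s + suc (d t y) ≤ k
  walk-crosses [] Wx W′x = ⊥-elim (W-disjoint Wx W′x)
  walk-crosses {x} (_∷_ {w = t} xt p) Wx W′y with side t
  ... | inj₂ W′t = x , t , (xt , Wx , W′t) , ≤-trans (+-monoˡ-≤ _ (≤-reflexive (d-refl x))) (s≤s (d-minimal p))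
  ... | inj₁ Wt with walk-crosses p Wt W′y
  ...   | s , t′ , cr , short = s , t′ , cr , ≤-trans (+-monoˡ-≤ _ (d-adjˡ-≤ s xt)) (s≤s short)

module Halfspaces (G : Graph) (isMedian : IsMedian G) (a b : V G) (ab : Graph.Adj G a b) where
  open Graph G renaming (sym to Adj-sym)
  open Metric G (proj₁ isMedian)
  open Median G isMedian using (W)
  open ThetaClass G isMedian a b ab
  module Swapped = ThetaClass G isMedian b a (Adj-sym ab)

  W⇒H″ : ∀ {w} → W b a w → H″ G a b w
  W⇒H″ = H′-swap⇒H″ G ∘ Swapped.W⇒H′

  H″⇒W : ∀ {w} → H″ G a b w → W b a w
  H″⇒W = Swapped.H′⇒W ∘ H″⇒H′-swap G

  halfspace-cover : ∀ w → H′ G a b w ⊎ H″ G a b w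
  halfspace-cover w with side w
  ... | inj₁ Ww = inj₁ (W⇒H′ Ww)
  ... | inj₂ W′w = inj₂ (W⇒H″ W′w)

  H′-dist : ∀ {x y} → H′ G a b x → H′ G a b y → DistR (Induced Adj (H′ G a b)) x y (d x y)
  H′-dist Hx Hy = convex⇒induced-dist W-convex W⇒H′ (H′⇒W Hx) (H′⇒W Hy)

  H″-dist : ∀ {x y} → H″ G a b x → H″ G a b y → DistR (Induced Adj (H″ G a b)) x y (d x y)
  H″-dist Hx Hy = convex⇒induced-dist Swapped.W-convex W⇒H″ (H″⇒W Hx) (H″⇒W Hy)

  gate-splits-distance : ∀ {v v* w} → H′ G a b v → IsGate G (∂H″ G a b) v v* → H″ G a b w →
                         d v w ≡ d v v* + d v* w
  gate-splits-distance {v} {v*} {w} Hv (_ , gate) Hw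
    with walk-crosses (geodesic v w) (H′⇒W Hv) (H″⇒W Hw)
  ... | s , t , (st , Ws , W′t) , short = ≤-antisym (d-triangle v v* w) (begin
    d v v* + d v* w           ≤⟨ +-monoʳ-≤ (d v v*) (d-triangle v* t w) ⟩
    d v v* + (d v* t + d t w) ≡⟨ sym (+-assoc (d v v*) _ _) ⟩
    d v v* + d v* t + d t w   ≡⟨ cong (_+ d t w) (sym through-gate) ⟩
    d v t + d t w             ≤⟨ +-monoˡ-≤ (d t w) (d-adjʳ-≤ v st) ⟩
    suc (d v s + d t w)       ≡⟨ sym (+-suc (d v s) (d t w)) ⟩
    d v s + suc (d t w)       ≤⟨ short ⟩
    d v w                     ∎)
    where
    open ≤-Reasoning
    through-gate : d v t ≡ d v v* + d v* t
    through-gate = gate t (W⇒H″ W′t , s , W⇒H′ Ws , Adj-sym st) _ _ _ (d-dist v t) (d-dist v v*) (d-dist v* t)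

lemma21 : (G : Graph) → IsMedian G →
    (a b : V G) → Graph.Adj G a b →
    (v : V G) → H′ G a b v →
    (v* : V G) → IsGate G (∂H″ G a b) v v* →
    (e e′ e″ d : ℕ) →
    Ecc G v e → EccIn G (H′ G a b) v e′ → EccIn G (H″ G a b) v* e″ →
    Dist G v v* d →
    e ≡ e′ ⊔ (d + e″)
lemma21 G isMedian a b ab v H′v v* gate e e′ e″ δ
        (ecc-max , w , vw) (ecc′-max , w′ , H′w′ , vw′) (ecc″-max , w″ , H″w″ , v*w″) vv* =
  ≤-antisym (subst (_≤ _) (sym (Dist⇒≡d vw)) (within-bound w))
            (⊔-lub (ecc-max w′ e′ (subst (Dist G v w′) (sym e′≡) (d-dist v w′)))
                   (subst (_≤ e) (sym δ+e″≡) (ecc-max w″ _ (d-dist v w″))))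
  where
  open Metric G (proj₁ isMedian)
  open Halfspaces G isMedian a b ab
  H″v* : H″ G a b v*
  H″v* = proj₁ (proj₁ gate)
  e′≡ : e′ ≡ d v w′
  e′≡ = DistR-unique vw′ (H′-dist H′v H′w′)
  δ+e″≡ : δ + e″ ≡ d v w″
  δ+e″≡ = trans (cong₂ _+_ (Dist⇒≡d vv*) (DistR-unique v*w″ (H″-dist H″v* H″w″)))
                (sym (gate-splits-distance H′v gate H″w″))
  within-bound : ∀ x → d v x ≤ e′ ⊔ (δ + e″)
  within-bound x with halfspace-cover x
  ... | inj₁ H′x = m≤n⇒m≤n⊔o _ (ecc′-max x H′x _ (H′-dist H′v H′x))
  ... | inj₂ H″x = m≤n⇒m≤o⊔n e′ (begin
    d v x           ≡⟨ gate-splits-distance H′v gate H″x ⟩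
    d v v* + d v* x ≤⟨ +-mono-≤ (≤-reflexive (sym (Dist⇒≡d vv*))) (ecc″-max x H″x _ (H″-dist H″v* H″x)) ⟩
    δ + e″          ∎)
    where open ≤-Reasoning
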